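{- Let $\mathbb{K}=(G,M,I)$ be a finite formal context with concept lattice $\underline{\mathfrak{B}}(\mathbb{K})$, and let $\underline{S}$ be an interval of $\underline{\mathfrak{B}}(\mathbb{K})$ with $|\underline{S}|=1$, say $\underline{S}=\{c\}$. Then $\underline{S}$ is dismantling for $\underline{\mathfrak{B}}(\mathbb{K})$ if and only if $c$ is doubly irreducible.
   Context: The concept lattice $\underline{\mathfrak{B}}(\mathbb{K})$ is the set of formal concepts $(A,B)$ ($A'=B$, $B'=A$) ordered by extent inclusion; it has least element $\bot$ and greatest element $\top$. For $u\le v$, $[u,v]=\{x\mid u\le x\le v\}$, $(v]=\{x\mid x\le v\}$, $[u)=\{x\mid u\le x\}$. An interval $[u,v]$ is dismantling for a lattice $L$ if $u$ is supremum-prime in $(v]$ (for all $x,y\in (v]$: $u\le x\vee y$ implies $u\le x$ or $u\le y$), $v$ is infimum-prime in $[u)$ (for all $x,y\in[u)$: $x\wedge y\le v$ implies $x\le v$ or $y\le v$), $u\neq\bot$ and $v\neq\top$. For $c\in L$ let $c_*=\bigvee\{x\mid x<c\}$ and $c^*=\bigwedge\{x\mid x>c\}$; $c$ is supremum-irreducible if $c_*<c$, infimum-irreducible if $c^*>c$, and doubly irreducible if both hold. -}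

module Defs where

open import Data.Nat using (ℕ)
open import Data.Fin using (Fin)
open import Data.Bool using (Bool; true)
open import Data.Fin.Subset using (Subset; _∈_; _⊆_)
open import Data.Product using (_×_; Σ)
open import Data.Sum using (_⊎_)
open import Relation.Nullary using (¬_)
open import Relation.Binary.PropositionalEquality using (_≡_)
open import Function.Bundles using (_⇔_)

record Context : Set where
  field
    objects    : ℕ
    attributes : ℕ
    incidence  : Fin objects → Fin attributes → Bool

module _ (K : Context) where
  open Context K

  _I_ : Fin objects → Fin attributes → Set
  g I μ = incidence g μ ≡ true

  -- A formal concept (A,B): A' = B and B' = A, written pointwise.
  record Concept : Set where
    field
      extent : Subset objects
      intent : Subset attributes
      intent-is-derived : ∀ μ → (μ ∈ intent) ⇔ (∀ g → g ∈ extent → g I μ)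
      extent-is-derived : ∀ g → (g ∈ extent) ⇔ (∀ μ → μ ∈ intent → g I μ)
  open Concept public

  _≤_ : Concept → Concept → Set
  x ≤ y = extent x ⊆ extent y

  -- equality of concepts (a concept is determined by its extent)
  _≈_ : Concept → Concept → Set
  x ≈ y = extent x ≡ extent y

  _<_ : Concept → Concept → Set
  x < y = x ≤ y × ¬ (x ≈ y)

  IsSup : (Concept → Set) → Concept → Set
  IsSup P s = (∀ x → P x → x ≤ s) × (∀ z → (∀ x → P x → x ≤ z) → s ≤ z)

  IsInf : (Concept → Set) → Concept → Set
  IsInf P s = (∀ x → P x → s ≤ x) × (∀ z → (∀ x → P x → z ≤ x) → z ≤ s)

  IsJoin : Concept → Concept → Concept → Set
  IsJoin x y j = IsSup (λ z → z ≈ x ⊎ z ≈ y) j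

  IsMeet : Concept → Concept → Concept → Set
  IsMeet x y j = IsInf (λ z → z ≈ x ⊎ z ≈ y) j

  SupPrimeIn↓ : Concept → Concept → Set
  SupPrimeIn↓ u v = ∀ x y → x ≤ v → y ≤ v → ∀ j → IsJoin x y j → u ≤ j → u ≤ x ⊎ u ≤ y

  InfPrimeIn↑ : Concept → Concept → Set
  InfPrimeIn↑ v u = ∀ x y → u ≤ x → u ≤ y → ∀ j → IsMeet x y j → j ≤ v → x ≤ v ⊎ y ≤ v

  IsBottom : Concept → Set
  IsBottom b = ∀ x → b ≤ x

  IsTop : Concept → Set
  IsTop t = ∀ x → x ≤ t

  Dismantling : Concept → Concept → Set
  Dismantling u v = SupPrimeIn↓ u v × InfPrimeIn↑ v u × ¬ IsBottom u × ¬ IsTop v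

  SupIrreducible : Concept → Set
  SupIrreducible c = ∀ s → IsSup (λ x → x < c) s → s < c

  InfIrreducible : Concept → Set
  InfIrreducible c = ∀ s → IsInf (λ x → c < x) s → c < s

  DoublyIrreducible : Concept → Set
  DoublyIrreducible c = SupIrreducible c × InfIrreducible c

{-# OPTIONS --safe #-}
-- In a finite lattice c_* is the join of the finitely many join-generators strictly below c.
-- If c is supremum-prime in (c] and not the bottom, c ≰ c_*: primality would push c below one
-- of those generators, each strictly below c.  Conversely, if c_* < c and x, y ≤ c both fail
-- to lie above c, then x, y ≤ c_*, hence x ∨ y ≤ c_* and c ≰ x ∨ y; and a bottom element c is
-- its own c_*.  The dual statement is the same argument in the order dual, with attribute
-- concepts as generators in place of object concepts; and [u, v] = {c} forces u = c = v.
module Submission where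

open import Data.Bool using (true)
open import Data.Bool.Properties using (T-≡) renaming (_≟_ to _≟ᵇ_)
open import Data.Fin using (Fin)
open import Data.Fin.Properties using (all?)
open import Data.Fin.Subset using (Subset; _∈_; _⊆_; _∪_; _∩_; ⁅_⁆) renaming (⊥ to ∅; ⊤ to full)
open import Data.Fin.Subset.Properties
  using (_∈?_; _⊆?_; ⊆-isPartialOrder; ∉⊥; ∈⊤; x∈⁅x⁆; x∈⁅y⁆⇒x≡y; x∈p∪q⁺; x∈p∪q⁻; p∩q⊆p; p∩q⊆q; x∈p∩q⁺)
open import Data.List using (List; []; _∷_; filter; map; allFin)
import Data.List.Membership.Propositional as List
open import Data.List.Membership.Propositional.Properties using (∈-filter⁺; ∈-map⁺; ∈-allFin)
open import Data.List.Relation.Unary.All as All using (All; []; _∷_)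
open import Data.List.Relation.Unary.All.Properties using (all-filter)
open import Data.List.Relation.Unary.Any using (here; there)
open import Data.Product using (_×_; _,_; proj₁; proj₂)
import Data.Product as Product
open import Data.Sum using (_⊎_; inj₁; inj₂; [_,_])
import Data.Sum as Sum
open import Data.Vec using (tabulate)
open import Data.Vec.Properties using (lookup∘tabulate; []=⇒lookup; lookup⇒[]=)
open import Function using (id; _∘_; flip; _⇔_; mk⇔; Equivalence)
open import Function.Construct.Symmetry using (⇔-sym)
open import Level using (0ℓ)
open import Relation.Binary using (Rel; IsPartialOrder; Decidable; Minimum; Maximum)
open import Relation.Binary.Lattice using (Supremum; Infimum)
import Relation.Binary.Construct.On as On
import Relation.Binary.Construct.Flip.Ord as Flip
open import Relation.Binary.PropositionalEquality using (refl; subst)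
import Relation.Binary.PropositionalEquality as ≡
open import Relation.Nullary using (¬_; Dec; yes; no; contradiction)
import Relation.Nullary.Decidable as Dec
open import Relation.Nullary.Decidable using (isYes; _×-dec_; ¬?; _→-dec_; toWitness; fromWitness)
import Relation.Unary as U

open Equivalence using (to; from)

⟦_⟧ : ∀ {n} {P : U.Pred (Fin n) 0ℓ} → U.Decidable P → Subset n
⟦ P? ⟧ = tabulate (isYes ∘ P?)

∈⟦⟧⇔ : ∀ {n} {P : U.Pred (Fin n) 0ℓ} (P? : U.Decidable P) {i} → i ∈ ⟦ P? ⟧ ⇔ P i
∈⟦⟧⇔ P? {i} = mk⇔
  (λ i∈ → toWitness (from T-≡ (≡.trans (≡.sym (lookup∘tabulate (isYes ∘ P?) i)) ([]=⇒lookup i∈))))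
  (λ Pi → lookup⇒[]= i _ (≡.trans (lookup∘tabulate (isYes ∘ P?) i) (to T-≡ (fromWitness Pi))))

module PrimeIrreducible
  {A : Set} {_≈_ _≤_ : Rel A 0ℓ} (isPartialOrder : IsPartialOrder _≈_ _≤_)
  (_≤?_ : Decidable _≤_)
  (_∨_ : A → A → A) (∨-supremum : Supremum _≤_ _∨_)
  (⊥ : A) (⊥-minimum : Minimum _≤_ ⊥)
  (generators : List A)
  (generators-joinDense : ∀ x z → (∀ {g} → g List.∈ generators → g ≤ x → g ≤ z) → x ≤ z)
  where

  open IsPartialOrder isPartialOrder

  -- The notions of Defs, for an arbitrary order; in the order dual they become
  -- IsInf, IsMeet (up to ≈-orientation), InfPrimeIn↑, IsTop and InfIrreducible.
  _<_ : Rel A 0ℓ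
  x < y = x ≤ y × ¬ (x ≈ y)

  IsSup : (A → Set) → A → Set
  IsSup P s = (∀ x → P x → x ≤ s) × (∀ z → (∀ x → P x → x ≤ z) → s ≤ z)

  IsJoin : A → A → A → Set
  IsJoin x y j = IsSup (λ z → z ≈ x ⊎ z ≈ y) j

  SupPrimeIn↓ : A → A → Set
  SupPrimeIn↓ u v = ∀ x y → x ≤ v → y ≤ v → ∀ j → IsJoin x y j → u ≤ j → u ≤ x ⊎ u ≤ y

  IsBottom : A → Set
  IsBottom b = ∀ x → b ≤ x

  SupIrreducible : A → Set
  SupIrreducible c = ∀ s → IsSup (λ x → x < c) s → s < c

  ≈⇒≥ : ∀ {x y} → x ≈ y → y ≤ x
  ≈⇒≥ = reflexive ∘ Eq.sym

  <⇒≱ : ∀ {x y} → x < y → ¬ y ≤ x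
  <⇒≱ (x≤y , x≉y) y≤x = x≉y (antisym x≤y y≤x)

  ≤∧≱⇔< : ∀ {x y} → (x ≤ y × ¬ y ≤ x) ⇔ x < y
  ≤∧≱⇔< = mk⇔ (λ (x≤y , y≰x) → x≤y , y≰x ∘ ≈⇒≥) (λ x<y → proj₁ x<y , <⇒≱ x<y)

  _<?_ : Decidable _<_
  x <? y = Dec.map ≤∧≱⇔< (x ≤? y ×-dec ¬? (y ≤? x))

  ≤-<-trans : ∀ {x y z} → x ≤ y → y < z → x < z
  ≤-<-trans x≤y y<z@(y≤z , _) = trans x≤y y≤z , λ x≈z → <⇒≱ y<z (trans (≈⇒≥ x≈z) x≤y)

  IsSup-cong : ∀ {P Q : A → Set} {s} → (∀ {x} → P x ⇔ Q x) → IsSup P s → IsSup Q s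
  IsSup-cong P⇔Q (upper , least) =
    (λ x → upper x ∘ from P⇔Q) , (λ z bound → least z (λ x → bound x ∘ to P⇔Q))

  IsJoin⇔IsSup-flip≈ : ∀ {x y j} → IsJoin x y j ⇔ IsSup (λ z → x ≈ z ⊎ y ≈ z) j
  IsJoin⇔IsSup-flip≈ {x} {y} {j} = mk⇔
    (IsSup-cong {λ z → z ≈ x ⊎ z ≈ y} {λ z → x ≈ z ⊎ y ≈ z} {j} flip≈)
    (IsSup-cong {λ z → x ≈ z ⊎ y ≈ z} {λ z → z ≈ x ⊎ z ≈ y} {j} (⇔-sym flip≈))
    where
    flip≈ : ∀ {a b z} → (z ≈ a ⊎ z ≈ b) ⇔ (a ≈ z ⊎ b ≈ z)
    flip≈ = mk⇔ (Sum.map Eq.sym Eq.sym) (Sum.map Eq.sym Eq.sym)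

  isJoin-least : ∀ {x y j z} → IsJoin x y j → x ≤ z → y ≤ z → j ≤ z
  isJoin-least (_ , least) x≤z y≤z =
    least _ (λ w → [ (λ w≈x → trans (reflexive w≈x) x≤z) , (λ w≈y → trans (reflexive w≈y) y≤z) ])

  ∨-isJoin : ∀ x y → IsJoin x y (x ∨ y)
  ∨-isJoin x y = upper , (λ z bound → ∨-least z (bound x (inj₁ Eq.refl)) (bound y (inj₂ Eq.refl)))
    where
    x≤x∨y : x ≤ (x ∨ y)
    x≤x∨y = proj₁ (∨-supremum x y)
    y≤x∨y : y ≤ (x ∨ y)
    y≤x∨y = proj₁ (proj₂ (∨-supremum x y))
    ∨-least : ∀ z → x ≤ z → y ≤ z → (x ∨ y) ≤ z
    ∨-least = proj₂ (proj₂ (∨-supremum x y))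
    upper : ∀ z → z ≈ x ⊎ z ≈ y → z ≤ (x ∨ y)
    upper z = [ (λ z≈x → trans (reflexive z≈x) x≤x∨y) , (λ z≈y → trans (reflexive z≈y) y≤x∨y) ]

  ⋁ : List A → A
  ⋁ []       = ⊥
  ⋁ (x ∷ xs) = x ∨ ⋁ xs

  ∈⇒≤⋁ : ∀ {x xs} → x List.∈ xs → x ≤ ⋁ xs
  ∈⇒≤⋁ {xs = y ∷ ys} (here refl)  = proj₁ (∨-supremum y (⋁ ys))
  ∈⇒≤⋁ {xs = y ∷ ys} (there x∈ys) = trans (∈⇒≤⋁ x∈ys) (proj₁ (proj₂ (∨-supremum y (⋁ ys))))

  ⋁-least : ∀ {xs z} → All (_≤ z) xs → ⋁ xs ≤ z
  ⋁-least []           = ⊥-minimum _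
  ⋁-least (x≤z ∷ xs≤z) = proj₂ (proj₂ (∨-supremum _ _)) _ x≤z (⋁-least xs≤z)

  supPrime⇒≰⋁ : ∀ {c xs} → SupPrimeIn↓ c c → ¬ IsBottom c → All (_< c) xs → ¬ c ≤ ⋁ xs
  supPrime⇒≰⋁ prime c≠⊥ [] c≤⊥ = c≠⊥ (λ x → trans c≤⊥ (⊥-minimum x))
  supPrime⇒≰⋁ {xs = x ∷ xs} prime c≠⊥ (x<c ∷ xs<c) c≤x∨⋁xs =
    [ <⇒≱ x<c , supPrime⇒≰⋁ prime c≠⊥ xs<c ]
      (prime x (⋁ xs) (proj₁ x<c) (⋁-least (All.map proj₁ xs<c)) _ (∨-isJoin x (⋁ xs)) c≤x∨⋁xs)

  generatorsBelow : A → List A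
  generatorsBelow c = filter (_<? c) generators

  lowerJoin : A → A
  lowerJoin c = ⋁ (generatorsBelow c)

  lowerJoin-isSup : ∀ c → IsSup (_< c) (lowerJoin c)
  lowerJoin-isSup c = upper , least
    where
    upper : ∀ x → x < c → x ≤ lowerJoin c
    upper x x<c = generators-joinDense x (lowerJoin c)
      (λ g∈gens g≤x → ∈⇒≤⋁ (∈-filter⁺ (_<? c) g∈gens (≤-<-trans g≤x x<c)))
    least : ∀ z → (∀ x → x < c → x ≤ z) → lowerJoin c ≤ z
    least z bound = ⋁-least (All.map (bound _) (all-filter (_<? c) generators))

  supPrime⇒supIrreducible : ∀ {c} → SupPrimeIn↓ c c → ¬ IsBottom c → SupIrreducible c
  supPrime⇒supIrreducible {c} prime c≠⊥ s (_ , s-least) = s≤c , s≉c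
    where
    s≤c : s ≤ c
    s≤c = s-least c (λ _ → proj₁)
    s≉c : ¬ s ≈ c
    s≉c s≈c = supPrime⇒≰⋁ prime c≠⊥ (all-filter (_<? c) generators)
      (trans (≈⇒≥ s≈c) (s-least _ (proj₁ (lowerJoin-isSup c))))

  supIrreducible⇒supPrime : ∀ {c} → SupIrreducible c → SupPrimeIn↓ c c
  supIrreducible⇒supPrime {c} irr x y x≤c y≤c j j-isJoin c≤j with c ≤? x | c ≤? y
  ... | yes c≤x | _       = inj₁ c≤x
  ... | no _    | yes c≤y = inj₂ c≤y
  ... | no c≰x  | no c≰y  = contradiction c≤lowerJoin (<⇒≱ (irr _ (lowerJoin-isSup c)))
    where
    below : ∀ {w} → w ≤ c → ¬ c ≤ w → w ≤ lowerJoin c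
    below w≤c c≰w = proj₁ (lowerJoin-isSup c) _ (w≤c , c≰w ∘ ≈⇒≥)
    c≤lowerJoin : c ≤ lowerJoin c
    c≤lowerJoin = trans c≤j (isJoin-least j-isJoin (below x≤c c≰x) (below y≤c c≰y))

  supIrreducible⇒¬bottom : ∀ {c} → SupIrreducible c → ¬ IsBottom c
  supIrreducible⇒¬bottom {c} irr c-bottom = proj₂ (irr c ((λ _ → proj₁) , (λ z _ → c-bottom z))) Eq.refl

  SupPrimeIn↓-resp-≈ : ∀ {u u′ v v′} → u ≈ u′ → v ≈ v′ → SupPrimeIn↓ u v → SupPrimeIn↓ u′ v′
  SupPrimeIn↓-resp-≈ u≈u′ v≈v′ prime x y x≤v′ y≤v′ j j-isJoin u′≤j =
    Sum.map (trans (≈⇒≥ u≈u′)) (trans (≈⇒≥ u≈u′))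
      (prime x y (trans x≤v′ (≈⇒≥ v≈v′)) (trans y≤v′ (≈⇒≥ v≈v′)) j j-isJoin (trans (reflexive u≈u′) u′≤j))

  IsBottom-resp-≈ : ∀ {b b′} → b ≈ b′ → IsBottom b → IsBottom b′
  IsBottom-resp-≈ b≈b′ b-bottom x = trans (≈⇒≥ b≈b′) (b-bottom x)

  supPrime×¬bottom⇔supIrreducible : ∀ {u v c} → u ≈ c → v ≈ c →
    (SupPrimeIn↓ u v × ¬ IsBottom u) ⇔ SupIrreducible c
  supPrime×¬bottom⇔supIrreducible u≈c v≈c = mk⇔
    (λ (prime , u≠⊥) → supPrime⇒supIrreducible (SupPrimeIn↓-resp-≈ u≈c v≈c prime)
                                                (u≠⊥ ∘ IsBottom-resp-≈ (Eq.sym u≈c)))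
    (λ irr → SupPrimeIn↓-resp-≈ (Eq.sym u≈c) (Eq.sym v≈c) (supIrreducible⇒supPrime irr)
           , supIrreducible⇒¬bottom irr ∘ IsBottom-resp-≈ u≈c)

open import Defs

module ConceptLattice (K : Context) where
  open Context K

  _≤ᴷ_ : Rel (Concept K) 0ℓ
  _≤ᴷ_ = _≤_ K

  _≈ᴷ_ : Rel (Concept K) 0ℓ
  _≈ᴷ_ = _≈_ K

  I? : ∀ g μ → Dec (_I_ K g μ)
  I? g μ = incidence g μ ≟ᵇ true

  _↑ : Subset objects → Subset attributes
  A ↑ = ⟦ (λ μ → all? (λ g → g ∈? A →-dec I? g μ)) ⟧

  _↓ : Subset attributes → Subset objects
  B ↓ = ⟦ (λ g → all? (λ μ → μ ∈? B →-dec I? g μ)) ⟧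

  ∈↑⇔ : ∀ {A μ} → μ ∈ A ↑ ⇔ (∀ g → g ∈ A → _I_ K g μ)
  ∈↑⇔ = ∈⟦⟧⇔ _

  ∈↓⇔ : ∀ {B g} → g ∈ B ↓ ⇔ (∀ μ → μ ∈ B → _I_ K g μ)
  ∈↓⇔ = ∈⟦⟧⇔ _

  ⊆↑↓ : ∀ A → A ⊆ A ↑ ↓
  ⊆↑↓ A g∈A = from ∈↓⇔ (λ μ μ∈A↑ → to ∈↑⇔ μ∈A↑ _ g∈A)

  closure : Subset objects → Concept K
  closure A = record
    { extent = A ↑ ↓
    ; intent = A ↑
    ; intent-is-derived = λ μ → mk⇔
        (λ μ∈A↑ g g∈A↑↓ → to ∈↓⇔ g∈A↑↓ μ μ∈A↑)
        (λ common → from ∈↑⇔ (λ g g∈A → common g (⊆↑↓ A g∈A)))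
    ; extent-is-derived = λ g → ∈↓⇔
    }

  closure-least : ∀ {A} z → A ⊆ extent z → closure A ≤ᴷ z
  closure-least z A⊆z g∈A↑↓ = from (extent-is-derived z _) (λ μ μ∈z →
    to ∈↓⇔ g∈A↑↓ μ (from ∈↑⇔ (λ g g∈A → to (intent-is-derived z μ) μ∈z g (A⊆z g∈A))))

  ≤-isPartialOrder : IsPartialOrder _≈ᴷ_ _≤ᴷ_
  ≤-isPartialOrder = On.isPartialOrder extent (⊆-isPartialOrder objects)

  ≥-isPartialOrder : IsPartialOrder (flip _≈ᴷ_) (flip _≤ᴷ_)
  ≥-isPartialOrder = Flip.isPartialOrder ≤-isPartialOrder

  _≤?_ : Decidable _≤ᴷ_
  x ≤? y = extent x ⊆? extent y

  _≥?_ : Decidable (flip _≤ᴷ_)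
  _≥?_ = flip _≤?_

  _∨_ : Concept K → Concept K → Concept K
  x ∨ y = closure (extent x ∪ extent y)

  ∨-supremum : Supremum _≤ᴷ_ _∨_
  ∨-supremum x y =
      ⊆↑↓ _ ∘ x∈p∪q⁺ ∘ inj₁
    , ⊆↑↓ _ ∘ x∈p∪q⁺ ∘ inj₂
    , λ z x≤z y≤z → closure-least z ([ x≤z , y≤z ] ∘ x∈p∪q⁻ _ _)

  _∧_ : Concept K → Concept K → Concept K
  x ∧ y = closure (extent x ∩ extent y)

  ∧-infimum : Infimum _≤ᴷ_ _∧_
  ∧-infimum x y =
      closure-least x (p∩q⊆p _ _)
    , closure-least y (p∩q⊆q _ _)
    , λ z z≤x z≤y g∈z → ⊆↑↓ _ (x∈p∩q⁺ (z≤x g∈z , z≤y g∈z))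

  ⊥ᴷ : Concept K
  ⊥ᴷ = closure ∅

  ⊥-minimum : Minimum _≤ᴷ_ ⊥ᴷ
  ⊥-minimum z = closure-least z (λ g∈∅ → contradiction g∈∅ ∉⊥)

  ⊤ᴷ : Concept K
  ⊤ᴷ = closure full

  ⊤-maximum : Maximum _≤ᴷ_ ⊤ᴷ
  ⊤-maximum z _ = ⊆↑↓ full ∈⊤

  objectConcept : Fin objects → Concept K
  objectConcept g = closure ⁅ g ⁆

  ∈-objectConcept : ∀ g → g ∈ extent (objectConcept g)
  ∈-objectConcept g = ⊆↑↓ ⁅ g ⁆ (x∈⁅x⁆ g)

  objectConcept-least : ∀ {g} x → g ∈ extent x → objectConcept g ≤ᴷ x
  objectConcept-least {g} x g∈x =
    closure-least x (λ h∈⁅g⁆ → subst (_∈ extent x) (≡.sym (x∈⁅y⁆⇒x≡y g h∈⁅g⁆)) g∈x)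

  attributeConcept : Fin attributes → Concept K
  attributeConcept μ = closure ⟦ (λ g → I? g μ) ⟧

  ∈-attributeConcept : ∀ μ → μ ∈ intent (attributeConcept μ)
  ∈-attributeConcept μ = from ∈↑⇔ (λ g → to (∈⟦⟧⇔ _))

  attributeConcept-greatest : ∀ {μ} x → μ ∈ intent x → x ≤ᴷ attributeConcept μ
  attributeConcept-greatest {μ} x μ∈x g∈x =
    ⊆↑↓ _ (from (∈⟦⟧⇔ _) (to (intent-is-derived x μ) μ∈x _ g∈x))

  objectConcepts : List (Concept K)
  objectConcepts = map objectConcept (allFin objects)

  attributeConcepts : List (Concept K)
  attributeConcepts = map attributeConcept (allFin attributes)

  objectConcepts-joinDense : ∀ x z → (∀ {c} → c List.∈ objectConcepts → c ≤ᴷ x → c ≤ᴷ z) → x ≤ᴷ z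
  objectConcepts-joinDense x z below {g} g∈x =
    below (∈-map⁺ objectConcept (∈-allFin g)) (objectConcept-least x g∈x) (∈-objectConcept g)

  attributeConcepts-meetDense : ∀ x z → (∀ {c} → c List.∈ attributeConcepts → x ≤ᴷ c → z ≤ᴷ c) → z ≤ᴷ x
  attributeConcepts-meetDense x z above {g} g∈z = from (extent-is-derived x g) (λ μ μ∈x →
    to (extent-is-derived (attributeConcept μ) g)
       (above (∈-map⁺ attributeConcept (∈-allFin μ)) (attributeConcept-greatest x μ∈x) g∈z)
       μ (∈-attributeConcept μ))

  module Primal = PrimeIrreducible ≤-isPartialOrder _≤?_ _∨_ ∨-supremum ⊥ᴷ ⊥-minimum
                    objectConcepts objectConcepts-joinDense

  module Dual = PrimeIrreducible ≥-isPartialOrder _≥?_ _∧_ ∧-infimum ⊤ᴷ ⊤-maximum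
                  attributeConcepts attributeConcepts-meetDense

  -- Flip.Ord also flips ≈, so a dual join is described by x ≈ z where IsMeet has z ≈ x.
  isMeet⇔dualIsJoin : ∀ {x y j} → IsMeet K x y j ⇔ Dual.IsJoin x y j
  isMeet⇔dualIsJoin {x} {y} {j} = ⇔-sym (Dual.IsJoin⇔IsSup-flip≈ {x} {y} {j})

  infPrime⇔dualSupPrime : ∀ {u v} → InfPrimeIn↑ K v u ⇔ Dual.SupPrimeIn↓ v u
  infPrime⇔dualSupPrime = mk⇔
    (λ prime x y u≤x u≤y j → prime x y u≤x u≤y j ∘ from (isMeet⇔dualIsJoin {x} {y} {j}))
    (λ prime x y u≤x u≤y j → prime x y u≤x u≤y j ∘ to (isMeet⇔dualIsJoin {x} {y} {j}))

  infPrime×¬top⇔infIrreducible : ∀ {u v c} → u ≈ᴷ c → v ≈ᴷ c →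
    (InfPrimeIn↑ K v u × ¬ IsTop K v) ⇔ InfIrreducible K c
  infPrime×¬top⇔infIrreducible {u} {v} {c} u≈c v≈c = mk⇔
    (to dual ∘ Product.map₁ (to (infPrime⇔dualSupPrime {u} {v})))
    (Product.map₁ (from (infPrime⇔dualSupPrime {u} {v})) ∘ from dual)
    where
    dual : (Dual.SupPrimeIn↓ v u × ¬ IsTop K v) ⇔ InfIrreducible K c
    dual = Dual.supPrime×¬bottom⇔supIrreducible {v} {u} {c} (≡.sym v≈c) (≡.sym u≈c)

proposition2 : (K : Context) (u v c : Concept K) → _≤_ K u v →
    (∀ x → (_≤_ K u x × _≤_ K x v) ⇔ _≈_ K x c) →
    Dismantling K u v ⇔ DoublyIrreducible K c
proposition2 K u v c u≤v interval = mk⇔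
  (λ (supPrime , infPrime , u≠⊥ , v≠⊤) → to sup (supPrime , u≠⊥) , to inf (infPrime , v≠⊤))
  (λ (supIrr , infIrr) → let (supPrime , u≠⊥) = from sup supIrr
                             (infPrime , v≠⊤) = from inf infIrr
                         in supPrime , infPrime , u≠⊥ , v≠⊤)
  where
  open ConceptLattice K
  u≈c : u ≈ᴷ c
  u≈c = to (interval u) (id , u≤v)
  v≈c : v ≈ᴷ c
  v≈c = to (interval v) (u≤v , id)
  sup : (SupPrimeIn↓ K u v × ¬ IsBottom K u) ⇔ SupIrreducible K c
  sup = Primal.supPrime×¬bottom⇔supIrreducible {u} {v} {c} u≈c v≈c
  inf : (InfPrimeIn↑ K v u × ¬ IsTop K v) ⇔ InfIrreducible K c
  inf = infPrime×¬top⇔infIrreducible {u} {v} {c} u≈c v≈c
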